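{- Let $\mathcal{R},\mathcal{S}$ be non-duplicating TRSs over $\mathcal{F}$ and $c\in\mathbb{N}$. If $\mathcal{R}$ is non-collapsing then $\to_{\mathrm{MATCH}_c(\mathcal{R})}\subseteq\ >^c_{\mathrm{mul}}$ and $\to_{\mathrm{MATCHRT}_c(\mathcal{S})}\subseteq\ \ge^c_{\mathrm{mul}}$.
   Context: Non-duplicating: no variable occurs more often in $r$ than in $l$ for a rule $l\to r$; non-collapsing: no right-hand side is a variable. For $N\subseteq\mathbb{N}$, $\mathcal{F}_N$ has symbols $f_c$ ($f\in\mathcal{F},c\in N$); $\mathrm{lift}_c(f)=f_c$, $\mathrm{base}(f_c)=f$, $\mathrm{height}(f_c)=c$, extended to terms and TRSs. $\mathrm{FPos}(t)$: positions of function symbols; $\|t\|$: number of function symbol occurrences. $\mathrm{match}(\mathcal{R})$: rules $l'\to\mathrm{lift}_d(r)$ with $l\to r\in\mathcal{R}$, $\mathrm{base}(l')=l$, $d=1+\min\{\mathrm{height}(l'(p))\mid p\in\mathrm{FPos}(l)\}$; $\mathrm{MATCH}_c(\mathcal{R})$ is its restriction to rules over $\mathcal{F}_{\{0,\dots,c\}}$. $\mathrm{MATCHRT}^c(\mathcal{S})$: rules $l'\to\mathrm{lift}_d(r)$ with $\mathrm{base}(l')\to r\in\mathcal{S}$, $d=\min\{c,\mathrm{height}(l'(\epsilon))\}$ if $\|\mathrm{base}(l')\|\ge\|r\|$ and $\mathrm{lift}_{\mathrm{height}(l'(\epsilon))}(\mathrm{base}(l'))=l'$, otherwise $d=\min(\{c\}\cup\{1+\mathrm{height}(l'(p))\mid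 p\in\mathrm{FPos}(l')\})$; $\mathrm{MATCHRT}_c(\mathcal{S})$ is its restriction to rules over $\mathcal{F}_{\{0,\dots,c\}}$. For finite multisets $M,N$ over $\mathbb{N}$: $M>_{\mathrm{mul}}N$ iff there are multisets $X\ne\varnothing$, $Y$ with $N=(M\setminus X)\cup Y$ and for every $m\in Y$ some $n\in X$ with $n<m$; $M\ge_{\mathrm{mul}}N$ iff $M>_{\mathrm{mul}}N$ or $M=N$. $\mathrm{drop}(M,c)$ removes all occurrences of $c$ from $M$; $M>^c_{\mathrm{mul}}N$ iff $\mathrm{drop}(M,c)>_{\mathrm{mul}}\mathrm{drop}(N,c)$, similarly $\ge^c_{\mathrm{mul}}$. For terms $s,t$ over $\mathcal{F}_{\mathbb{N}}$, $s>^c_{\mathrm{mul}}t$ iff $\mathrm{MFun}(s)>^c_{\mathrm{mul}}\mathrm{MFun}(t)$ (similarly $\ge^c_{\mathrm{mul}}$), where $\mathrm{MFun}(t)=\{\mathrm{height}(t(p))\mid p\in\mathrm{FPos}(t)\}$ as a multiset. -}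

module Defs where

open import Data.Nat using (ℕ; zero; suc; _+_; _≤_; _<_; _≥_; _⊓_; _≟_; _≡ᵇ_)
open import Data.Bool using (if_then_else_)
open import Data.Product using (Σ; ∃; _×_; _,_; proj₁; proj₂)
open import Data.Sum using (_⊎_)
open import Data.List using (List; []; _∷_; _++_; filter)
import Data.List
open import Data.List.Relation.Unary.All using (All)
open import Data.List.Relation.Unary.Any using (Any)
open import Data.List.Membership.Propositional using (_∈_)
open import Data.List.Relation.Binary.Permutation.Propositional using (_↭_)
open import Data.Vec using (Vec; []; _∷_; lookup; _[_]≔_)
open import Data.Fin using (Fin)
open import Relation.Nullary using (¬_; ¬?)
open import Relation.Binary.PropositionalEquality using (_≡_; _≢_)

record Signature : Set₁ where
  field
    Sym : Set
    ar  : Sym → ℕ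
open Signature public

data Term (Sg : Signature) : Set where
  var : ℕ → Term Sg
  fun : (f : Sym Sg) → Vec (Term Sg) (ar Sg f) → Term Sg

-- the labelled signature F_ℕ : symbols f_c = (f , c) with arity of f
lab : Signature → Signature
lab Sg = record { Sym = Sym Sg × ℕ ; ar = λ p → ar Sg (proj₁ p) }

module _ {Sg : Signature} where

  Rule : Set
  Rule = Term Sg × Term Sg

  TRS : Set₁
  TRS = Rule → Set

  mutual
    _⟨_⟩ : Term Sg → (ℕ → Term Sg) → Term Sg
    var x ⟨ σ ⟩ = σ x
    fun f ts ⟨ σ ⟩ = fun f (substs ts σ)

    substs : ∀ {n} → Vec (Term Sg) n → (ℕ → Term Sg) → Vec (Term Sg) n
    substs [] σ = []
    substs (t ∷ ts) σ = (t ⟨ σ ⟩) ∷ substs ts σ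

  mutual
    occ : ℕ → Term Sg → ℕ
    occ x (var y) = if x ≡ᵇ y then 1 else 0
    occ x (fun f ts) = occs x ts

    occs : ∀ {n} → ℕ → Vec (Term Sg) n → ℕ
    occs x [] = 0
    occs x (t ∷ ts) = occ x t + occs x ts

  mutual
    size : Term Sg → ℕ
    size (var x) = 0
    size (fun f ts) = suc (sizes ts)

    sizes : ∀ {n} → Vec (Term Sg) n → ℕ
    sizes [] = 0
    sizes (t ∷ ts) = size t + sizes ts

  IsVar : Term Sg → Set
  IsVar t = ∃ λ x → t ≡ var x

  IsTRS : TRS → Set
  IsTRS R = ∀ {l r} → R (l , r) → ¬ IsVar l × (∀ x → 0 < occ x r → 0 < occ x l)

  NonDuplicating : TRS → Set
  NonDuplicating R = ∀ {l r} → R (l , r) → ∀ x → occ x r ≤ occ x l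

  NonCollapsing : TRS → Set
  NonCollapsing R = ∀ {l r} → R (l , r) → ¬ IsVar r

  data Step (R : TRS) : Term Sg → Term Sg → Set where
    root : ∀ {l r} (σ : ℕ → Term Sg) → R (l , r) → Step R (l ⟨ σ ⟩) (r ⟨ σ ⟩)
    cong : ∀ f (ts : Vec (Term Sg) (ar Sg f)) (i : Fin (ar Sg f)) {u} →
           Step R (lookup ts i) u → Step R (fun f ts) (fun f (ts [ i ]≔ u))

module _ {Sg : Signature} where

  mutual
    lift : ℕ → Term Sg → Term (lab Sg)
    lift c (var x) = var x
    lift c (fun f ts) = fun (f , c) (lifts c ts)

    lifts : ∀ {n} → ℕ → Vec (Term Sg) n → Vec (Term (lab Sg)) n
    lifts c [] = []
    lifts c (t ∷ ts) = lift c t ∷ lifts c ts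

  mutual
    base : Term (lab Sg) → Term Sg
    base (var x) = var x
    base (fun (f , c) ts) = fun f (bases ts)

    bases : ∀ {n} → Vec (Term (lab Sg)) n → Vec (Term Sg) n
    bases [] = []
    bases (t ∷ ts) = base t ∷ bases ts

  mutual
    MFun : Term (lab Sg) → List ℕ
    MFun (var x) = []
    MFun (fun (f , c) ts) = c ∷ MFuns ts

    MFuns : ∀ {n} → Vec (Term (lab Sg)) n → List ℕ
    MFuns [] = []
    MFuns (t ∷ ts) = MFun t ++ MFuns ts

  IsMin : ℕ → List ℕ → Set
  IsMin m xs = m ∈ xs × All (m ≤_) xs

  OverUpTo : ℕ → Rule {lab Sg} → Set
  OverUpTo c (l , r) = All (_≤ c) (MFun l) × All (_≤ c) (MFun r)

  data Match (R : TRS {Sg}) : Rule {lab Sg} → Set where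
    mk : ∀ {l r l' m} → R (l , r) → base l' ≡ l → IsMin m (MFun l') →
         Match R (l' , lift (suc m) r)

  MATCH : ℕ → TRS {Sg} → TRS {lab Sg}
  MATCH c R ρ = Match R ρ × OverUpTo c ρ

  -- MATCHRT^c(S); l' = f_k(ts) is necessarily non-variable as base(l') is a lhs
  data MatchRT (c : ℕ) (S : TRS {Sg}) : Rule {lab Sg} → Set where
    mk-eq : ∀ {f k ts r} → S (base (fun (f , k) ts) , r) →
            size (base (fun (f , k) ts)) ≥ size r →
            lift k (base (fun (f , k) ts)) ≡ fun (f , k) ts →
            MatchRT c S (fun (f , k) ts , lift (c ⊓ k) r)
    mk-other : ∀ {f k ts r d} → S (base (fun (f , k) ts) , r) →
            ¬ (size (base (fun (f , k) ts)) ≥ size r ×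
               lift k (base (fun (f , k) ts)) ≡ fun (f , k) ts) →
            IsMin d (c ∷ Data.List.map suc (MFun (fun (f , k) ts))) →
            MatchRT c S (fun (f , k) ts , lift d r)

  MATCHRT : ℕ → TRS {Sg} → TRS {lab Sg}
  MATCHRT c S ρ = MatchRT c S ρ × OverUpTo c ρ

-- multisets over ℕ, represented by lists up to permutation

_>mul_ : List ℕ → List ℕ → Set
M >mul N = ∃ λ X → ∃ λ Y → ∃ λ Z →
  X ≢ [] × M ↭ X ++ Z × N ↭ Z ++ Y × All (λ m → Any (λ n → n < m) X) Y

_≥mul_ : List ℕ → List ℕ → Set
M ≥mul N = M >mul N ⊎ M ↭ N

drop : List ℕ → ℕ → List ℕ
drop M c = filter (λ x → ¬? (x ≟ c)) M

_>mul[_]_ : List ℕ → ℕ → List ℕ → Set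
M >mul[ c ] N = drop M c >mul drop N c

_≥mul[_]_ : List ℕ → ℕ → List ℕ → Set
M ≥mul[ c ] N = drop M c ≥mul drop N c

module _ {Sg : Signature} where
  _>ᵗ[_]_ : Term (lab Sg) → ℕ → Term (lab Sg) → Set
  s >ᵗ[ c ] t = MFun s >mul[ c ] MFun t

  _≥ᵗ[_]_ : Term (lab Sg) → ℕ → Term (lab Sg) → Set
  s ≥ᵗ[ c ] t = MFun s ≥mul[ c ] MFun t

module Submission where

-- Every function symbol occurrence of a term over F_ℕ carries a height, and
-- MFun t is the multiset of these heights.  A rewrite step C[lσ] → C[rσ]
-- changes this multiset only locally:
--   MFun (C[lσ]) = MFun l ⊎ (heights of σ at the variables of l) ⊎ (context),
--   MFun (C[rσ]) = MFun r ⊎ (heights of σ at the variables of r) ⊎ (context),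
-- and for a non-duplicating rule the variables of r form a submultiset of the
-- variables of l.  Hence every relation on multisets which is invariant under
-- permutation, closed under adding a common part, and under enlarging its left
-- side ("compatible") contains all rewrite steps whose rules satisfy
-- MFun l ⊳ MFun r (lemma step-decreasing).

open import Defs
open import Data.Nat using (ℕ; zero; suc; _+_; _∸_; _≤_; _<_; _⊓_; _≟_; _≡ᵇ_; z≤n; s≤s)
open import Data.Nat.Properties
  using ( ≡ᵇ⇒≡; +-cancelˡ-≤; +-assoc; +-comm; +-identityʳ; <-irrefl; <-≤-trans
        ; m+[n∸m]≡n; m≥n⇒m⊓n≡n; ≤-refl)
open import Data.Bool using (true; false; if_then_else_; T)
open import Data.Product using (∃; _×_; _,_)
open import Data.Sum using (inj₁; inj₂)
open import Data.List using (List; []; _∷_; _++_; replicate; concatMap)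
open import Data.List.Properties using (filter-++; filter-none; ++-identityʳ; concatMap-++)
open import Data.List.Relation.Unary.All using (All; []; _∷_)
import Data.List.Relation.Unary.All as All
import Data.List.Relation.Unary.All.Properties as All
open import Data.List.Relation.Unary.Any using (here; there)
import Data.List.Relation.Unary.Any as Any
import Data.List.Relation.Unary.Any.Properties as Any
open import Data.List.Membership.Propositional using (_∈_)
open import Data.List.Membership.Propositional.Properties using (∈-∃++; ∈-map⁻; ∈-filter⁺)
open import Data.List.Relation.Binary.Permutation.Propositional
  using (_↭_; refl; prep; swap; trans; ↭-refl; ↭-trans; ↭-sym; ↭-reflexive; module PermutationReasoning)
open import Data.List.Relation.Binary.Permutation.Propositional.Properties
  using (++⁺ˡ; ++⁺ʳ; ++⁺; ++-assoc; ++-comm; shift; shifts; filter-↭)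
open import Data.Vec using (Vec; []; _∷_; lookup; _[_]≔_)
open import Data.Fin using (zero; suc)
open import Relation.Nullary using (¬_; ¬?)
open import Data.Empty using (⊥-elim)
open import Relation.Binary.PropositionalEquality
  using (_≡_; _≢_; refl; sym; cong₂; subst; subst₂; module ≡-Reasoning)
  renaming (cong to ≡-cong; trans to ≡-trans)

-- Finite multisets as lists up to permutation

_⊆ₘ_ : List ℕ → List ℕ → Set
xs ⊆ₘ ys = ∃ λ E → ys ↭ xs ++ E

++-interchange : (a b c d : List ℕ) → (a ++ b) ++ (c ++ d) ↭ (a ++ c) ++ (b ++ d)
++-interchange a b c d = begin
  (a ++ b) ++ (c ++ d)  ↭⟨ ++-assoc a b (c ++ d) ⟩
  a ++ (b ++ (c ++ d))  ↭⟨ ++⁺ˡ a (shifts b c) ⟩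
  a ++ (c ++ (b ++ d))  ↭⟨ ↭-sym (++-assoc a c (b ++ d)) ⟩
  (a ++ c) ++ (b ++ d)  ∎
  where open PermutationReasoning

-- These are exactly the closure properties used to
-- pass from rules to rewrite steps.
record Compatible (_⊳_ : List ℕ → List ℕ → Set) : Set where
  field
    resp-↭    : ∀ {M M′ N N′} → M ↭ M′ → N ↭ N′ → M ⊳ N → M′ ⊳ N′
    ++-common : ∀ {M N} C → M ⊳ N → (M ++ C) ⊳ (N ++ C)
    ++-left   : ∀ {M N} E → M ⊳ N → (M ++ E) ⊳ N

dominated : ∀ {h M N} → h ∈ M → All (h <_) N → M >mul N
dominated {N = N} h∈M h<N =
  _ , N , [] , nonempty h∈M , ↭-sym (↭-reflexive (++-identityʳ _)) , ↭-refl ,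
  All.map (λ h<m → Any.map (λ { refl → h<m }) h∈M) h<N
  where
  nonempty : ∀ {x M} → x ∈ M → M ≢ []
  nonempty (here _) ()
  nonempty (there _) ()

submultiset-≥ : ∀ {M N} E → M ↭ N ++ E → M ≥mul N
submultiset-≥ [] M↭N = inj₂ (↭-trans M↭N (↭-reflexive (++-identityʳ _)))
submultiset-≥ {N = N} (e ∷ E) M↭N++E =
  inj₁ (e ∷ E , [] , N , (λ ()) , ↭-trans M↭N++E (++-comm N (e ∷ E)) ,
        ↭-sym (↭-reflexive (++-identityʳ N)) , [])

>mul-compatible : Compatible _>mul_
>mul-compatible = record { resp-↭ = resp ; ++-common = common ; ++-left = left }
  where
  resp : ∀ {M M′ N N′} → M ↭ M′ → N ↭ N′ → M >mul N → M′ >mul N′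
  resp M↭ N↭ (X , Y , Z , X≢[] , M↭XZ , N↭ZY , below) =
    X , Y , Z , X≢[] , ↭-trans (↭-sym M↭) M↭XZ , ↭-trans (↭-sym N↭) N↭ZY , below

  common : ∀ {M N} C → M >mul N → (M ++ C) >mul (N ++ C)
  common C (X , Y , Z , X≢[] , M↭XZ , N↭ZY , below) =
    X , Y , Z ++ C , X≢[] ,
    ↭-trans (++⁺ʳ C M↭XZ) (++-assoc X Z C) ,
    ↭-trans (++⁺ʳ C N↭ZY) (↭-trans (++-assoc Z Y C)
      (↭-trans (++⁺ˡ Z (++-comm Y C)) (↭-sym (++-assoc Z C Y)))) ,
    below

  left : ∀ {M N} E → M >mul N → (M ++ E) >mul N
  left E (X , Y , Z , X≢[] , M↭XZ , N↭ZY , below) =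
    X ++ E , Y , Z , grown X≢[] ,
    ↭-trans (++⁺ʳ E M↭XZ) (↭-trans (++-assoc X Z E)
      (↭-trans (++⁺ˡ X (++-comm Z E)) (↭-sym (++-assoc X E Z)))) ,
    N↭ZY , All.map Any.++⁺ˡ below
    where
    grown : ∀ {X} → X ≢ [] → X ++ E ≢ []
    grown {[]} X≢[] = λ _ → X≢[] refl
    grown {_ ∷ _} _ ()

≥mul-compatible : Compatible _≥mul_
≥mul-compatible = record { resp-↭ = resp ; ++-common = common ; ++-left = left }
  where
  open Compatible >mul-compatible renaming (resp-↭ to >resp; ++-common to >common; ++-left to >left)

  resp : ∀ {M M′ N N′} → M ↭ M′ → N ↭ N′ → M ≥mul N → M′ ≥mul N′
  resp M↭ N↭ (inj₁ M>N) = inj₁ (>resp M↭ N↭ M>N)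
  resp M↭ N↭ (inj₂ M↭N) = inj₂ (↭-trans (↭-sym M↭) (↭-trans M↭N N↭))

  common : ∀ {M N} C → M ≥mul N → (M ++ C) ≥mul (N ++ C)
  common C (inj₁ M>N) = inj₁ (>common C M>N)
  common C (inj₂ M↭N) = inj₂ (++⁺ʳ C M↭N)

  left : ∀ {M N} E → M ≥mul N → (M ++ E) ≥mul N
  left E (inj₁ M>N) = inj₁ (>left E M>N)
  left E (inj₂ M↭N) = submultiset-≥ E (++⁺ʳ E M↭N)

drop-↭ : ∀ c {M N} → M ↭ N → drop M c ↭ drop N c
drop-↭ c = filter-↭ (λ x → ¬? (x ≟ c))

drop-++ : ∀ c M N → drop (M ++ N) c ≡ drop M c ++ drop N c
drop-++ c = filter-++ (λ x → ¬? (x ≟ c))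

drop-compatible : ∀ {_⊳_} c → Compatible _⊳_ → Compatible (λ M N → drop M c ⊳ drop N c)
drop-compatible {_⊳_} c comp = record
  { resp-↭    = λ M↭ N↭ → resp-↭ (drop-↭ c M↭) (drop-↭ c N↭)
  ; ++-common = λ {M} {N} C M⊳N →
      resp-↭ (drop-++↭ M C) (drop-++↭ N C) (++-common (drop C c) M⊳N)
  ; ++-left   = λ {M} E M⊳N → resp-↭ (drop-++↭ M E) ↭-refl (++-left (drop E c) M⊳N)
  }
  where
  open Compatible comp
  drop-++↭ : ∀ M N → drop M c ++ drop N c ↭ drop (M ++ N) c
  drop-++↭ M N = ↭-reflexive (sym (drop-++ c M N))

dominated-drop : ∀ {c h M N} → h ∈ M → h ≢ c → All (h <_) N → M >mul[ c ] N
dominated-drop {c} h∈M h≢c h<N =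
  dominated (∈-filter⁺ (λ x → ¬? (x ≟ c)) h∈M h≢c) (All.filter⁺ (λ x → ¬? (x ≟ c)) h<N)

drop-empty-≥ : ∀ {c} M N → drop N c ≡ [] → M ≥mul[ c ] N
drop-empty-≥ {c} M N N↓≡[] = subst (drop M c ≥mul_) (sym N↓≡[]) (submultiset-≥ (drop M c) ↭-refl)

drop-submultiset-≥ : ∀ {c M N} E → M ↭ N ++ E → M ≥mul[ c ] N
drop-submultiset-≥ {c} {N = N} E M↭N++E =
  submultiset-≥ (drop E c) (↭-trans (drop-↭ c M↭N++E) (↭-reflexive (drop-++ c N E)))

-- Indicator of x ≡ y, in the form used by `occ`.
δ : ℕ → ℕ → ℕ
δ x y = if x ≡ᵇ y then 1 else 0

δ-self : ∀ x → δ x x ≡ 1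
δ-self zero = refl
δ-self (suc x) = δ-self x

mult : ℕ → List ℕ → ℕ
mult x [] = 0
mult x (y ∷ ys) = δ x y + mult x ys

mult-++ : ∀ x xs ys → mult x (xs ++ ys) ≡ mult x xs + mult x ys
mult-++ x [] ys = refl
mult-++ x (y ∷ xs) ys = begin
  δ x y + mult x (xs ++ ys)         ≡⟨ ≡-cong (δ x y +_) (mult-++ x xs ys) ⟩
  δ x y + (mult x xs + mult x ys)   ≡⟨ sym (+-assoc (δ x y) (mult x xs) (mult x ys)) ⟩
  (δ x y + mult x xs) + mult x ys   ∎
  where open ≡-Reasoning

mult-insert : ∀ z as x bs → mult z (as ++ x ∷ bs) ≡ δ z x + mult z (as ++ bs)
mult-insert z as x bs = begin
  mult z (as ++ x ∷ bs)                ≡⟨ mult-++ z as (x ∷ bs) ⟩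
  mult z as + (δ z x + mult z bs)      ≡⟨ sym (+-assoc (mult z as) (δ z x) (mult z bs)) ⟩
  (mult z as + δ z x) + mult z bs      ≡⟨ ≡-cong (_+ mult z bs) (+-comm (mult z as) (δ z x)) ⟩
  (δ z x + mult z as) + mult z bs      ≡⟨ +-assoc (δ z x) (mult z as) (mult z bs) ⟩
  δ z x + (mult z as + mult z bs)      ≡⟨ ≡-cong (δ z x +_) (sym (mult-++ z as bs)) ⟩
  δ z x + mult z (as ++ bs)            ∎
  where open ≡-Reasoning

mult-∈ : ∀ x ys → 0 < mult x ys → x ∈ ys
mult-∈ x (y ∷ ys) pos with x ≡ᵇ y in eq
... | true  = here (≡ᵇ⇒≡ x y (subst T (sym eq) _))
... | false = there (mult-∈ x ys pos)

mult-⊆ₘ : ∀ xs ys → (∀ z → mult z xs ≤ mult z ys) → xs ⊆ₘ ys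
mult-⊆ₘ [] ys _ = ys , ↭-refl
mult-⊆ₘ (x ∷ xs) ys le with ∈-∃++ (mult-∈ x ys x-occurs)
  where
  x-occurs : 0 < mult x ys
  x-occurs = <-≤-trans (subst (λ n → 0 < n + mult x xs) (sym (δ-self x)) (s≤s z≤n)) (le x)
... | as , bs , refl with mult-⊆ₘ xs (as ++ bs) le′
  where
  le′ : ∀ z → mult z xs ≤ mult z (as ++ bs)
  le′ z = +-cancelˡ-≤ (δ z x) _ _ (subst (mult z (x ∷ xs) ≤_) (mult-insert z as x bs) (le z))
... | E , p = E , ↭-trans (shift x as bs) (prep x p)

-- Variables of terms

module _ {Sg : Signature} where

  mutual
    vars : Term Sg → List ℕ
    vars (var x) = x ∷ []
    vars (fun f ts) = varss ts

    varss : ∀ {n} → Vec (Term Sg) n → List ℕ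
    varss [] = []
    varss (t ∷ ts) = vars t ++ varss ts

  mutual
    occ-mult : ∀ x t → occ x t ≡ mult x (vars t)
    occ-mult x (var y) = sym (+-identityʳ (δ x y))
    occ-mult x (fun f ts) = occs-mult x ts

    occs-mult : ∀ {n} x (ts : Vec (Term Sg) n) → occs x ts ≡ mult x (varss ts)
    occs-mult x [] = refl
    occs-mult x (t ∷ ts) =
      ≡-trans (cong₂ _+_ (occ-mult x t) (occs-mult x ts)) (sym (mult-++ x (vars t) (varss ts)))

module _ {Sg : Signature} where

  mutual
    vars-base : (t : Term (lab Sg)) → vars (base t) ≡ vars t
    vars-base (var x) = refl
    vars-base (fun (f , k) ts) = varss-base ts

    varss-base : ∀ {n} (ts : Vec (Term (lab Sg)) n) → varss (bases ts) ≡ varss ts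
    varss-base [] = refl
    varss-base (t ∷ ts) = cong₂ _++_ (vars-base t) (varss-base ts)

  mutual
    vars-lift : ∀ d (t : Term Sg) → vars (lift d t) ≡ vars t
    vars-lift d (var x) = refl
    vars-lift d (fun f ts) = varss-lift d ts

    varss-lift : ∀ {n} d (ts : Vec (Term Sg) n) → varss (lifts d ts) ≡ varss ts
    varss-lift d [] = refl
    varss-lift d (t ∷ ts) = cong₂ _++_ (vars-lift d t) (varss-lift d ts)

  lift-⊆ₘ : ∀ (l′ : Term (lab Sg)) d r → (∀ x → occ x r ≤ occ x (base l′)) →
            vars (lift d r) ⊆ₘ vars l′
  lift-⊆ₘ l′ d r nondup = mult-⊆ₘ (vars (lift d r)) (vars l′) λ z →
    subst₂ _≤_
      (≡-trans (occ-mult z r) (≡-cong (mult z) (sym (vars-lift d r))))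
      (≡-trans (occ-mult z (base l′)) (≡-cong (mult z) (vars-base l′)))
      (nondup z)

replicate-+ : ∀ a b (x : ℕ) → replicate (a + b) x ≡ replicate a x ++ replicate b x
replicate-+ zero b x = refl
replicate-+ (suc a) b x = ≡-cong (x ∷_) (replicate-+ a b x)

replicate-∸ : ∀ {m n} (x : ℕ) → n ≤ m → replicate m x ≡ replicate n x ++ replicate (m ∸ n) x
replicate-∸ {m} {n} x n≤m = begin
  replicate m x                          ≡⟨ ≡-cong (λ k → replicate k x) (sym (m+[n∸m]≡n n≤m)) ⟩
  replicate (n + (m ∸ n)) x              ≡⟨ replicate-+ n (m ∸ n) x ⟩
  replicate n x ++ replicate (m ∸ n) x   ∎
  where open ≡-Reasoning

module _ {Sg : Signature} where

  mutual
    MFun-lift : ∀ d (t : Term Sg) → MFun (lift d t) ≡ replicate (size t) d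
    MFun-lift d (var x) = refl
    MFun-lift d (fun f ts) = ≡-cong (d ∷_) (MFuns-lift d ts)

    MFuns-lift : ∀ {n} d (ts : Vec (Term Sg) n) → MFuns (lifts d ts) ≡ replicate (sizes ts) d
    MFuns-lift d [] = refl
    MFuns-lift d (t ∷ ts) = ≡-trans (cong₂ _++_ (MFun-lift d t) (MFuns-lift d ts))
                                    (sym (replicate-+ (size t) (sizes ts) d))

  lift-heights : ∀ {P : ℕ → Set} {d} (t : Term Sg) → P d → All P (MFun (lift d t))
  lift-heights {P} {d} t Pd = subst (All P) (sym (MFun-lift d t)) (All.replicate⁺ (size t) Pd)

  root-height : ∀ {P : ℕ → Set} {d} (t : Term Sg) → ¬ IsVar t → All P (MFun (lift d t)) → P d
  root-height (var x) t-nonvar _ = ⊥-elim (t-nonvar (x , refl))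
  root-height (fun f ts) _ (Pd ∷ _) = Pd

concatMap-↭ : ∀ (f : ℕ → List ℕ) {xs ys} → xs ↭ ys → concatMap f xs ↭ concatMap f ys
concatMap-↭ f refl = ↭-refl
concatMap-↭ f (prep x p) = ++⁺ˡ (f x) (concatMap-↭ f p)
concatMap-↭ f (swap x y p) = ↭-trans (shifts (f x) (f y)) (++⁺ˡ (f y) (++⁺ˡ (f x) (concatMap-↭ f p)))
concatMap-↭ f (trans p q) = ↭-trans (concatMap-↭ f p) (concatMap-↭ f q)

module _ {Sg : Signature} where

  heightsAt : (ℕ → Term (lab Sg)) → List ℕ → List ℕ
  heightsAt σ = concatMap (λ x → MFun (σ x))

  mutual
    MFun-subst : ∀ (t : Term (lab Sg)) σ → MFun (t ⟨ σ ⟩) ↭ MFun t ++ heightsAt σ (vars t)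
    MFun-subst (var x) σ = ↭-sym (↭-reflexive (++-identityʳ (MFun (σ x))))
    MFun-subst (fun (f , k) ts) σ = prep k (MFuns-subst ts σ)

    MFuns-subst : ∀ {n} (ts : Vec (Term (lab Sg)) n) σ →
                  MFuns (substs ts σ) ↭ MFuns ts ++ heightsAt σ (varss ts)
    MFuns-subst [] σ = ↭-refl
    MFuns-subst (t ∷ ts) σ = begin
      MFun (t ⟨ σ ⟩) ++ MFuns (substs ts σ)
        ↭⟨ ++⁺ (MFun-subst t σ) (MFuns-subst ts σ) ⟩
      (MFun t ++ heightsAt σ (vars t)) ++ (MFuns ts ++ heightsAt σ (varss ts))
        ↭⟨ ++-interchange (MFun t) _ (MFuns ts) _ ⟩
      (MFun t ++ MFuns ts) ++ (heightsAt σ (vars t) ++ heightsAt σ (varss ts))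
        ≡⟨ ≡-cong ((MFun t ++ MFuns ts) ++_) (sym (concatMap-++ (λ x → MFun (σ x)) (vars t) (varss ts))) ⟩
      (MFun t ++ MFuns ts) ++ heightsAt σ (vars t ++ varss ts) ∎
      where open PermutationReasoning

  MFuns-update : ∀ {n} (ts : Vec (Term (lab Sg)) n) i u → ∃ λ C →
                 MFuns ts ↭ MFun (lookup ts i) ++ C × MFuns (ts [ i ]≔ u) ↭ MFun u ++ C
  MFuns-update (t ∷ ts) zero u = MFuns ts , ↭-refl , ↭-refl
  MFuns-update (t ∷ ts) (suc i) u with MFuns-update ts i u
  ... | C , old , new =
    MFun t ++ C ,
    ↭-trans (++⁺ˡ (MFun t) old) (shifts (MFun t) (MFun (lookup ts i))) ,
    ↭-trans (++⁺ˡ (MFun t) new) (shifts (MFun t) (MFun u))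

-- From rules to rewrite steps

module _ {Sg : Signature} where

  Decreasing : (List ℕ → List ℕ → Set) → Rule {lab Sg} → Set
  Decreasing _⊳_ (l , r) = vars r ⊆ₘ vars l × MFun l ⊳ MFun r

  module _ {_⊳_ : List ℕ → List ℕ → Set} (comp : Compatible _⊳_) where
    open Compatible comp

    -- Root steps: the heights of σ at the variables of r are common to both
    -- sides, those at the remaining variables of l only enlarge the left side.
    root-decreasing : ∀ {l r} σ → Decreasing _⊳_ (l , r) → MFun (l ⟨ σ ⟩) ⊳ MFun (r ⟨ σ ⟩)
    root-decreasing {l} {r} σ ((E , l↭r+E) , l⊳r) =
      resp-↭ (↭-sym lσ) (↭-sym (MFun-subst r σ)) (++-left (heightsAt σ E) (++-common W l⊳r))
      where
      W = heightsAt σ (vars r)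
      lσ : MFun (l ⟨ σ ⟩) ↭ (MFun l ++ W) ++ heightsAt σ E
      lσ = begin
        MFun (l ⟨ σ ⟩)                         ↭⟨ MFun-subst l σ ⟩
        MFun l ++ heightsAt σ (vars l)            ↭⟨ ++⁺ˡ (MFun l) (concatMap-↭ _ l↭r+E) ⟩
        MFun l ++ heightsAt σ (vars r ++ E)       ≡⟨ ≡-cong (MFun l ++_) (concatMap-++ _ (vars r) E) ⟩
        MFun l ++ (W ++ heightsAt σ E)            ↭⟨ ↭-sym (++-assoc (MFun l) W (heightsAt σ E)) ⟩
        (MFun l ++ W) ++ heightsAt σ E            ∎
        where open PermutationReasoning

    step-decreasing : ∀ {T : TRS {lab Sg}} → (∀ {ρ} → T ρ → Decreasing _⊳_ ρ) →
                      ∀ {s t} → Step T s t → MFun s ⊳ MFun t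
    step-decreasing dec (root σ ρ∈T) = root-decreasing σ (dec ρ∈T)
    step-decreasing dec (cong (f , k) ts i {u} step) with MFuns-update ts i u
    ... | C , old , new =
      resp-↭ (under-root old) (under-root new) (++-common (k ∷ C) (step-decreasing dec step))
      where
      -- The root height k joins the common part of the arguments.
      under-root : ∀ {L A} → L ↭ A ++ C → A ++ (k ∷ C) ↭ k ∷ L
      under-root {A = A} L↭A+C = ↭-trans (shift k A C) (prep k (↭-sym L↭A+C))

-- The rules of MATCH_c(R) and MATCHRT_c(S)

module _ {Sg : Signature} (c : ℕ) where

  -- A rule l′ → lift_{m+1}(r) of MATCH_c(R) decreases strictly: m is a height
  -- of l′ below every height m + 1 of the right-hand side, and m ≠ c because r
  -- is not a variable, so its root height m + 1 is at most c.
  match-decreasing : ∀ {R : TRS {Sg}} → NonDuplicating R → NonCollapsing R →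
                     ∀ {ρ} → MATCH c R ρ → Decreasing (_>mul[ c ]_) ρ
  match-decreasing nondup noncollapsing (mk {l} {r} {l′} {m} lr∈R refl (m∈l′ , _) , (_ , r≤c)) =
    lift-⊆ₘ l′ (suc m) r (nondup lr∈R) ,
    dominated-drop m∈l′ (λ m≡c → <-irrefl m≡c m<c) (lift-heights r ≤-refl)
    where
    m<c : m < c
    m<c = root-height r (noncollapsing lr∈R) r≤c

  -- A rule of MATCHRT_c(S) either keeps a uniformly labelled left-hand side
  -- height k ≤ c on a right-hand side that is not larger (a submultiset), or
  -- labels the right-hand side by c (discarded) or by 1 + a height of l′.
  matchRT-decreasing : ∀ {S : TRS {Sg}} → NonDuplicating S →
                       ∀ {ρ} → MATCHRT c S ρ → Decreasing (_≥mul[ c ]_) ρ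
  matchRT-decreasing nondup (mk-eq {f} {k} {ts} {r} lr∈S r≤l uniform , (k≤c ∷ _ , _)) =
    lift-⊆ₘ l′ (c ⊓ k) r (nondup lr∈S) ,
    drop-submultiset-≥ (replicate (size (base l′) ∸ size r) k) (↭-reflexive heights)
    where
    l′ = fun (f , k) ts
    heights : MFun l′ ≡ MFun (lift (c ⊓ k) r) ++ replicate (size (base l′) ∸ size r) k
    heights = begin
      MFun l′                                                  ≡⟨ ≡-cong MFun (sym uniform) ⟩
      MFun (lift k (base l′))                                  ≡⟨ MFun-lift k (base l′) ⟩
      replicate (size (base l′)) k                             ≡⟨ replicate-∸ k r≤l ⟩
      replicate (size r) k ++ replicate (size (base l′) ∸ size r) k
        ≡⟨ ≡-cong (λ d → replicate (size r) d ++ _) (sym (m≥n⇒m⊓n≡n k≤c)) ⟩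
      replicate (size r) (c ⊓ k) ++ replicate (size (base l′) ∸ size r) k
        ≡⟨ ≡-cong (_++ _) (sym (MFun-lift (c ⊓ k) r)) ⟩
      MFun (lift (c ⊓ k) r) ++ replicate (size (base l′) ∸ size r) k ∎
      where open ≡-Reasoning
  matchRT-decreasing nondup (mk-other {f} {k} {ts} {r} {d} lr∈S _ (d∈ , d≤c ∷ _) , _)
    with d∈
  ... | here refl =
    lift-⊆ₘ l′ c r (nondup lr∈S) ,
    drop-empty-≥ (MFun l′) (MFun (lift c r))
      (≡-trans (≡-cong (λ M → drop M c) (MFun-lift c r)) (drop-replicate (size r)))
    where
    l′ = fun (f , k) ts
    drop-replicate : ∀ n → drop (replicate n c) c ≡ []
    drop-replicate n = filter-none (λ x → ¬? (x ≟ c)) (All.replicate⁺ n (λ c≢c → c≢c refl))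
  ... | there d∈suc-heights with ∈-map⁻ suc d∈suc-heights
  ...   | h , h∈l′ , refl =
    lift-⊆ₘ (fun (f , k) ts) (suc h) r (nondup lr∈S) ,
    inj₁ (dominated-drop h∈l′ (λ h≡c → <-irrefl h≡c d≤c) (lift-heights r ≤-refl))

lemma5p6 : (Sg : Signature) (R S : TRS {Sg}) (c : ℕ) →
    IsTRS R → IsTRS S → NonDuplicating R → NonDuplicating S →
    NonCollapsing R →
    (∀ s t → Step (MATCH c R) s t → s >ᵗ[ c ] t) ×
    (∀ s t → Step (MATCHRT c S) s t → s ≥ᵗ[ c ] t)
lemma5p6 Sg R S c _ _ nondupR nondupS noncollapsingR =
  (λ s t → step-decreasing (drop-compatible c >mul-compatible)
                            (match-decreasing c nondupR noncollapsingR)) ,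
  (λ s t → step-decreasing (drop-compatible c ≥mul-compatible)
                            (matchRT-decreasing c nondupS))
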